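{- Let $3\le n\le m$ be integers, and let $K_n$ denote the complete graph on $n$ vertices. Then $\mathcal{RH}(K_n,K_m)=\frac{m-n}{n}$.
   Context: For a graph $H$ without isolated vertices, $\Delta(H)$ is its maximum degree, $f_H(k)=|\{v: d(v)\ge k\}|$ for integers $k\ge1$, and the smooth ccdh is the piecewise-linear interpolation $\varphi_H(x)=(1-(x-\lfloor x\rfloor))f_H(\lfloor x\rfloor)+(x-\lfloor x\rfloor)f_H(\lfloor x\rfloor+1)$ for real $x\ge1$. The smooth directional Relative Hausdorff distance $\mathcal{RH}_r(F,G)$ is the minimum $\epsilon\ge0$ such that for every integer $d\in\{1,\dots,\Delta(F)\}$ there is a real $d'\in[1,\Delta(G)+1]$ with $|d-d'|\le\epsilon d$ and $|\varphi_F(d)-\varphi_G(d')|\le\epsilon\varphi_F(d)$; and $\mathcal{RH}(F,G)=\max\{\mathcal{RH}_r(F,G),\mathcal{RH}_r(G,F)\}$.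
   Formalization: The tolerance ε, the smaller tolerances excluded by the minimality in $\mathcal{RH}_r$, and the point $d'$ range over the rationals rather than the reals. -}

module Defs where

open import Data.Bool using (Bool; true; false; if_then_else_; T; not)
open import Data.Nat as ℕ using (ℕ; zero; suc)
import Data.Nat.Properties as ℕP
open import Data.Fin using (Fin; _≟_)
open import Data.List using (List; map; filter; length; foldr)
open import Data.Nat.ListAction using (sum)
open import Data.List using () renaming (allFin to allFinL)
open import Data.Integer as ℤ using (ℤ; +_)
open import Data.Rational as ℚ using (ℚ; _/_; _+_; _*_; _-_; _≤_; _<_; ∣_∣; _⊔_; 1ℚ; 0ℚ; floor)
open import Data.Product using (Σ; ∃; ∃-syntax; _×_; _,_)
open import Relation.Nullary using (¬_; does)
open import Relation.Binary.PropositionalEquality using (_≡_)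

record Graph (v : ℕ) : Set where
  field
    adj    : Fin v → Fin v → Bool
    adj-sym : ∀ x y → adj x y ≡ adj y x
    irrefl : ∀ x → adj x x ≡ false
open Graph public

K : (n : ℕ) → Graph n
K n = record { adj = λ x y → not (does (x ≟ y)) ; adj-sym = symK ; irrefl = irrK }
  where
  open import Relation.Nullary using (yes; no)
  open import Relation.Binary.PropositionalEquality using (refl) renaming (sym to ≡sym)
  symK : ∀ x y → not (does (x ≟ y)) ≡ not (does (y ≟ x))
  symK x y with x ≟ y | y ≟ x
  ... | yes _ | yes _ = refl
  ... | no _  | no _  = refl
  ... | yes p | no q  = Data.Empty.⊥-elim (q (≡sym p)) where import Data.Empty
  ... | no p  | yes q = Data.Empty.⊥-elim (p (≡sym q)) where import Data.Empty
  irrK : ∀ x → not (does (x ≟ x)) ≡ false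
  irrK x with x ≟ x
  ... | yes _ = refl
  ... | no p  = Data.Empty.⊥-elim (p refl) where import Data.Empty

degree : ∀ {v} → Graph v → Fin v → ℕ
degree {v} G x = sum (map (λ y → if adj G x y then 1 else 0) (allFinL v))

Δ : ∀ {v} → Graph v → ℕ
Δ {v} G = foldr ℕ._⊔_ 0 (map (degree G) (allFinL v))

NoIsolated : ∀ {v} → Graph v → Set
NoIsolated G = ∀ x → 1 ℕ.≤ degree G x

f : ∀ {v} → Graph v → ℕ → ℕ
f {v} G k = length (filter (λ x → k ℕ.≤? degree G x) (allFinL v))

ℕ→ℚ : ℕ → ℚ
ℕ→ℚ k = (+ k) / 1

-- smooth ccdh φ_H(x) = (1 - {x}) f_H(⌊x⌋) + {x} f_H(⌊x⌋+1)   (used for x ≥ 1)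
φ : ∀ {v} → Graph v → ℚ → ℚ
φ G x = (1ℚ - t) * ℕ→ℚ (f G k) + t * ℕ→ℚ (f G (suc k))
  where
  k : ℕ
  k = ℤ.∣ floor x ∣
  t : ℚ
  t = x - ((+ k) / 1)

RHrOK : ∀ {v w} → Graph v → Graph w → ℚ → Set
RHrOK F G ε =
  ∀ (d : ℕ) → 1 ℕ.≤ d → d ℕ.≤ Δ F →
    ∃[ d' ] (1ℚ ≤ d' × d' ≤ ℕ→ℚ (suc (Δ G))
             × ∣ ℕ→ℚ d - d' ∣ ≤ ε * ℕ→ℚ d
             × ∣ φ F (ℕ→ℚ d) - φ G d' ∣ ≤ ε * φ F (ℕ→ℚ d))

IsRHr : ∀ {v w} → Graph v → Graph w → ℚ → Set
IsRHr F G ε = 0ℚ ≤ ε × RHrOK F G ε × (∀ ε' → 0ℚ ≤ ε' → ε' < ε → ¬ RHrOK F G ε')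

IsRH : ∀ {v w} → Graph v → Graph w → ℚ → Set
IsRH F G ε = Σ ℚ λ a → Σ ℚ λ b → IsRHr F G a × IsRHr G F b × (a ⊔ b ≡ ε)

-- Every vertex of K_n has degree n − 1, so φ_{K_n} is the constant n on [1, n − 1] and
-- falls linearly, as n (n − x), to 0 on [n − 1, n].  From K_n to K_m each degree d can be
-- matched with itself at cost |n − m| = ((m − n)/n)·n, and degree 1 allows no cheaper
-- partner, since every d' within (m − n)/n of 1 still lies on the plateau of K_m.  From K_m
-- to K_n the degrees n, …, m − 1 must be sent onto the ramp of K_n; the extreme degree m − 1
-- forces 1 − ε ≤ β := n² / (nm + m − n), and the common partner (m − 1)β achieves 1 − β for
-- all of them.  Since 1 − β ≤ (m − n)/n, the maximum of the two directions is (m − n)/n.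
module Submission where

open import Defs
open import Data.Bool using (if_then_else_; not)
open import Data.Empty using (⊥)
open import Data.Fin using (Fin; _≟_)
open import Data.Integer as ℤ using (+_; -[1+_])
import Data.Integer.Properties as ℤ
open import Data.List using ([]; _∷_; map; length; foldr; tabulate)
open import Data.List using () renaming (allFin to allFinL)
open import Data.List.Properties using (map-tabulate; map-cong; filter-all; filter-none; length-tabulate)
open import Data.List.Relation.Unary.All.Properties using (tabulate⁺)
open import Data.Nat as ℕ using (ℕ; zero; suc; _∸_; s≤s; z≤n)
open import Data.Nat.Coprimality using (Coprime; 1-coprimeTo) renaming (sym to coprime-sym)
import Data.Nat.DivMod as ℕ
open import Data.Nat.ListAction using (sum)
import Data.Nat.Properties as ℕ
open import Data.Nat.Tactic.RingSolver using () renaming (solve-∀ to ℕ-solve-∀)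
open import Data.Product using (_×_; _,_; proj₁; ∃)
open import Data.Rational as ℚ
  using (ℚ; mkℚ; _/_; _+_; _*_; _-_; -_; _≤_; _<_; ∣_∣; 1ℚ; 0ℚ; floor; *≤*; *<*; Positive; NonNegative)
import Data.Rational.Properties as ℚ
open import Data.Rational.Solver using (module +-*-Solver)
import Data.Rational.Unnormalised as ℚᵘ
import Data.Rational.Unnormalised.Properties as ℚᵘ
open import Data.Sum using (_⊎_; inj₁; inj₂; [_,_]′)
open import Relation.Binary.PropositionalEquality
  using (_≡_; refl; sym; trans; cong; cong₂; subst; subst₂; module ≡-Reasoning)
open import Relation.Nullary using (¬_; does)

open +-*-Solver using (solve; _:+_; _:*_; _:-_; :-_; _:=_; con)

private
  ι : ℕ → ℚ
  ι = ℕ→ℚ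

ℕ→ℚ≡mkℚ : ∀ k → ι k ≡ mkℚ (+ k) 0 (coprime-sym (1-coprimeTo k))
ℕ→ℚ≡mkℚ k = ℚ.normalize-coprime (coprime-sym (1-coprimeTo k))

ℕ→ℚ-homo-+ : ∀ a b → ι (a ℕ.+ b) ≡ ι a + ι b
ℕ→ℚ-homo-+ a b rewrite ℕ→ℚ≡mkℚ a | ℕ→ℚ≡mkℚ b =
  cong (_/ 1) (sym (cong₂ ℤ._+_ (ℤ.*-identityʳ (+ a)) (ℤ.*-identityʳ (+ b))))

ℕ→ℚ-suc : ∀ n → ι (suc n) ≡ 1ℚ + ι n
ℕ→ℚ-suc = ℕ→ℚ-homo-+ 1

ℕ→ℚ-homo-* : ∀ a b → ι (a ℕ.* b) ≡ ι a * ι b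
ℕ→ℚ-homo-* a b rewrite ℕ→ℚ≡mkℚ a | ℕ→ℚ≡mkℚ b = cong (_/ 1) (sym (ℤ.+◃n≡+n (a ℕ.* b)))

ℕ→ℚ-mono-≤ : ∀ {a b} → a ℕ.≤ b → ι a ≤ ι b
ℕ→ℚ-mono-≤ {a} {b} a≤b rewrite ℕ→ℚ≡mkℚ a | ℕ→ℚ≡mkℚ b =
  *≤* (subst₂ ℤ._≤_ (sym (ℤ.*-identityʳ (+ a))) (sym (ℤ.*-identityʳ (+ b))) (ℤ.+≤+ a≤b))

ℕ→ℚ-cancel-≤ : ∀ {a b} → ι a ≤ ι b → a ℕ.≤ b
ℕ→ℚ-cancel-≤ {a} {b} a≤b rewrite ℕ→ℚ≡mkℚ a | ℕ→ℚ≡mkℚ b =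
  ℤ.drop‿+≤+ (subst₂ ℤ._≤_ (ℤ.*-identityʳ (+ a)) (ℤ.*-identityʳ (+ b)) (ℚ.drop-*≤* a≤b))

ℕ→ℚ-cancel-< : ∀ {a b} → ι a < ι b → a ℕ.< b
ℕ→ℚ-cancel-< {a} {b} a<b rewrite ℕ→ℚ≡mkℚ a | ℕ→ℚ≡mkℚ b =
  ℤ.drop‿+<+ (subst₂ ℤ._<_ (ℤ.*-identityʳ (+ a)) (ℤ.*-identityʳ (+ b)) (ℚ.drop-*<* a<b))

0≤ℕ→ℚ : ∀ k → 0ℚ ≤ ι k
0≤ℕ→ℚ k = ℕ→ℚ-mono-≤ (z≤n {k})

ℕ→ℚ-nonNeg : ∀ k → NonNegative (ι k)
ℕ→ℚ-nonNeg k rewrite ℕ→ℚ≡mkℚ k = _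

ℕ→ℚ-pos : ∀ k → Positive (ι (suc k))
ℕ→ℚ-pos k rewrite ℕ→ℚ≡mkℚ (suc k) = _

*-cancelʳ-≤-ℕ→ℚ : ∀ q .{{_ : ℕ.NonZero q}} {x y} → x * ι q ≤ y * ι q → x ≤ y
*-cancelʳ-≤-ℕ→ℚ (suc q) = ℚ.*-cancelʳ-≤-pos (ι (suc q)) {{ℕ→ℚ-pos q}}

/-*-ℕ→ℚ : ∀ p q .{{_ : ℕ.NonZero q}} → (+ p / q) * ι q ≡ ι p
/-*-ℕ→ℚ p (suc q) = ℚ.toℚᵘ-injective (begin
  ℚ.toℚᵘ ((+ p / suc q) * ι (suc q))
    ≈⟨ ℚ.toℚᵘ-homo-* (+ p / suc q) (ι (suc q)) ⟩
  ℚ.toℚᵘ (+ p / suc q) ℚᵘ.* ℚ.toℚᵘ (ι (suc q))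
    ≈⟨ ℚᵘ.*-cong (ℚ.toℚᵘ-fromℚᵘ (ℚᵘ.mkℚᵘ (+ p) q)) (ℚᵘ.≃-reflexive (cong ℚ.toℚᵘ (ℕ→ℚ≡mkℚ (suc q)))) ⟩
  ℚᵘ.mkℚᵘ (+ p) q ℚᵘ.* ℚᵘ.mkℚᵘ (+ suc q) 0
    ≈⟨ ℚᵘ.*≡* (ℤ.*-assoc (+ p) (+ suc q) (+ 1)) ⟩
  ℚᵘ.mkℚᵘ (+ p) 0
    ≡⟨ cong ℚ.toℚᵘ (sym (ℕ→ℚ≡mkℚ p)) ⟩
  ℚ.toℚᵘ (ι p) ∎)
  where open ℚᵘ.≃-Reasoning

m+k≡n⇒m≤n : ∀ {m n} k → m ℕ.+ k ≡ n → m ℕ.≤ n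
m+k≡n⇒m≤n {m} k refl = ℕ.m≤m+n m k

ℕ-scaled-≤⇒≤ : ∀ q .{{_ : ℕ.NonZero q}} {x y a b} → a ℕ.≤ b → x * ι q ≡ ι a → y * ι q ≡ ι b → x ≤ y
ℕ-scaled-≤⇒≤ q a≤b xq≡a yq≡b = *-cancelʳ-≤-ℕ→ℚ q (subst₂ _≤_ (sym xq≡a) (sym yq≡b) (ℕ→ℚ-mono-≤ a≤b))

p≤q⇒0≤q-p : ∀ {p q} → p ≤ q → 0ℚ ≤ q - p
p≤q⇒0≤q-p {p} {q} p≤q = subst (_≤ q - p) (ℚ.+-inverseʳ p) (ℚ.+-monoˡ-≤ (- p) p≤q)

0≤q-p⇒p≤q : ∀ {p q} → 0ℚ ≤ q - p → p ≤ q
0≤q-p⇒p≤q {p} {q} 0≤q-p = subst₂ _≤_ (ℚ.+-identityˡ p) (cancel q p) (ℚ.+-monoˡ-≤ p 0≤q-p)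
  where
  cancel : ∀ q p → q - p + p ≡ q
  cancel = solve 2 (λ q p → q :- p :+ p := q) refl

≤-via-difference : ∀ {a b c d} → c ≤ d → b - a ≡ d - c → a ≤ b
≤-via-difference c≤d eq = 0≤q-p⇒p≤q (subst (0ℚ ≤_) (sym eq) (p≤q⇒0≤q-p c≤d))

p≤∣p∣ : ∀ p → p ≤ ∣ p ∣
p≤∣p∣ p = [ (λ 0≤p → ℚ.≤-reflexive (sym (ℚ.0≤p⇒∣p∣≡p 0≤p))) , (λ p≤0 → ℚ.≤-trans p≤0 (ℚ.0≤∣p∣ p)) ]′
            (ℚ.≤-total 0ℚ p)

∣p-q∣≡∣q-p∣ : ∀ p q → ∣ p - q ∣ ≡ ∣ q - p ∣
∣p-q∣≡∣q-p∣ p q = trans (cong ∣_∣ (negate p q)) (ℚ.∣-p∣≡∣p∣ (q - p))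
  where
  negate : ∀ p q → p - q ≡ - (q - p)
  negate = solve 2 (λ p q → p :- q := :- (q :- p)) refl

∣p-q∣≡p-q : ∀ {p q} → q ≤ p → ∣ p - q ∣ ≡ p - q
∣p-q∣≡p-q q≤p = ℚ.0≤p⇒∣p∣≡p (p≤q⇒0≤q-p q≤p)

∣p-q∣≡q-p : ∀ {p q} → p ≤ q → ∣ p - q ∣ ≡ q - p
∣p-q∣≡q-p {p} {q} p≤q = trans (∣p-q∣≡∣q-p∣ p q) (∣p-q∣≡p-q p≤q)

∣p-q∣≤r⇒p-q≤r : ∀ {p q r} → ∣ p - q ∣ ≤ r → p - q ≤ r
∣p-q∣≤r⇒p-q≤r {p} {q} = ℚ.≤-trans (p≤∣p∣ (p - q))

∣p-q∣≤r⇒q-p≤r : ∀ {p q r} → ∣ p - q ∣ ≤ r → q - p ≤ r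
∣p-q∣≤r⇒q-p≤r {p} {q} ∣p-q∣≤r = ∣p-q∣≤r⇒p-q≤r {q} {p} (subst (_≤ _) (∣p-q∣≡∣q-p∣ p q) ∣p-q∣≤r)

floorℕ : ℚ → ℕ
floorℕ x = ℤ.∣ floor x ∣

floorℕ-mkℚ : ∀ a d .(c : Coprime a (suc d)) → floorℕ (mkℚ (+ a) d c) ≡ a ℕ./ suc d
floorℕ-mkℚ a d _ = trans (ℤ.abs-◃ _ _) (ℕ.*-identityˡ _)

floor-bracket : ∀ x → 0ℚ ≤ x → ι (floorℕ x) ≤ x × x < ι (suc (floorℕ x))
floor-bracket (mkℚ -[1+ a ] d _) 0≤x with () ← ℚ.drop-*≤* 0≤x
floor-bracket (mkℚ (+ a) d c) _
  rewrite floorℕ-mkℚ a d c | ℕ→ℚ≡mkℚ (a ℕ./ suc d) | ℕ→ℚ≡mkℚ (suc (a ℕ./ suc d))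
  = *≤* (subst₂ ℤ._≤_ (sym (ℤ.+◃n≡+n (q ℕ.* suc d))) (sym (ℤ.*-identityʳ (+ a))) (ℤ.+≤+ lower))
  , *<* (subst₂ ℤ._<_ (sym (ℤ.*-identityʳ (+ a))) (sym (ℤ.+◃n≡+n (suc q ℕ.* suc d))) (ℤ.+<+ upper))
  where
  q : ℕ
  q = a ℕ./ suc d
  division : a ≡ a ℕ.% suc d ℕ.+ q ℕ.* suc d
  division = ℕ.m≡m%n+[m/n]*n a (suc d)
  lower : q ℕ.* suc d ℕ.≤ a
  lower = subst (q ℕ.* suc d ℕ.≤_) (sym division) (ℕ.m≤n+m _ _)
  upper : a ℕ.< suc q ℕ.* suc d
  upper = subst (ℕ._< suc q ℕ.* suc d) (sym division) (ℕ.+-monoˡ-< (q ℕ.* suc d) (ℕ.m%n<n a (suc d)))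

interpolate : ℚ → ℚ → ℚ → ℚ
interpolate t u v = (1ℚ - t) * u + t * v

interpolate-same : ∀ t u → interpolate t u u ≡ u
interpolate-same = solve 2 (λ t u → (con 1ℚ :- t) :* u :+ t :* u := u) refl

interpolate-0 : ∀ u v → interpolate 0ℚ u v ≡ u
interpolate-0 = solve 2 (λ u v → (con 1ℚ :- con 0ℚ) :* u :+ con 0ℚ :* v := u) refl

interpolate-1 : ∀ u v → interpolate 1ℚ u v ≡ v
interpolate-1 = solve 2 (λ u v → (con 1ℚ :- con 1ℚ) :* u :+ con 1ℚ :* v := v) refl

φ-at-floor : ∀ {v} (G : Graph v) x →
             φ G x ≡ interpolate (x - ι (floorℕ x)) (ι (f G (floorℕ x))) (ι (f G (suc (floorℕ x))))
φ-at-floor G x = refl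

-- For x = k + 1 the floor is k + 1, not k, but both interpolations then give f (k + 1).
φ-unit-interval : ∀ {v} (G : Graph v) k x → ι k ≤ x → x ≤ ι (suc k) →
                  φ G x ≡ interpolate (x - ι k) (ι (f G k)) (ι (f G (suc k)))
φ-unit-interval G k x k≤x x≤k+1 =
  trans (φ-at-floor G x) (at-floor (floorℕ x) (floor-is-k-or-k+1 bracket) (proj₁ bracket))
  where
  bracket : ι (floorℕ x) ≤ x × x < ι (suc (floorℕ x))
  bracket = floor-bracket x (ℚ.≤-trans (0≤ℕ→ℚ k) k≤x)
  u v w : ℚ
  u = ι (f G k)
  v = ι (f G (suc k))
  w = ι (f G (suc (suc k)))
  floor-is-k-or-k+1 : ∀ {k₀} → ι k₀ ≤ x × x < ι (suc k₀) → k₀ ≡ k ⊎ k₀ ≡ suc k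
  floor-is-k-or-k+1 (k₀≤x , x<k₀+1) =
    [ (λ k₀<k+1 → inj₁ (ℕ.≤-antisym (ℕ.≤-pred k₀<k+1) (ℕ.≤-pred (ℕ→ℚ-cancel-< (ℚ.≤-<-trans k≤x x<k₀+1)))))
    , inj₂
    ]′ (ℕ.m≤n⇒m<n∨m≡n (ℕ→ℚ-cancel-≤ (ℚ.≤-trans k₀≤x x≤k+1)))
  add-sub : ∀ y → 1ℚ + y - y ≡ 1ℚ
  add-sub = solve 1 (λ y → con 1ℚ :+ y :- y := con 1ℚ) refl
  at-floor : ∀ k₀ → k₀ ≡ k ⊎ k₀ ≡ suc k → ι k₀ ≤ x →
             interpolate (x - ι k₀) (ι (f G k₀)) (ι (f G (suc k₀))) ≡ interpolate (x - ι k) u v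
  at-floor .k       (inj₁ refl) _     = refl
  at-floor .(suc k) (inj₂ refl) k+1≤x = begin
    interpolate (x - ι (suc k)) v w  ≡⟨ cong (λ t → interpolate t v w) x-k-1≡0 ⟩
    interpolate 0ℚ v w               ≡⟨ interpolate-0 v w ⟩
    v                                ≡⟨ interpolate-1 u v ⟨
    interpolate 1ℚ u v               ≡⟨ cong (λ t → interpolate t u v) x-k≡1 ⟨
    interpolate (x - ι k) u v        ∎
    where
    open ≡-Reasoning
    x≡k+1 : x ≡ ι (suc k)
    x≡k+1 = ℚ.≤-antisym x≤k+1 k+1≤x
    x-k-1≡0 : x - ι (suc k) ≡ 0ℚ
    x-k-1≡0 = trans (cong (_- ι (suc k)) x≡k+1) (ℚ.+-inverseʳ (ι (suc k)))
    x-k≡1 : x - ι k ≡ 1ℚ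
    x-k≡1 = trans (cong (_- ι k) (trans x≡k+1 (ℕ→ℚ-suc k))) (add-sub (ι k))

degree-K : ∀ n (x : Fin n) → degree (K n) x ≡ n ∸ 1
degree-K n x = trans (cong sum (map-tabulate (λ y → y) (λ y → if adj (K n) x y then 1 else 0))) (count n x)
  where
  ones : ∀ n → sum (tabulate {n = n} (λ _ → 1)) ≡ n
  ones zero    = refl
  ones (suc n) = cong suc (ones n)
  count : ∀ n (x : Fin n) → sum (tabulate (λ y → if not (does (x ≟ y)) then 1 else 0)) ≡ n ∸ 1
  count (suc n)       Fin.zero    = ones n
  count (suc (suc n)) (Fin.suc x) = cong suc (count (suc n) x)

Δ-K : ∀ n → Δ (K (suc n)) ≡ n
Δ-K n = trans (cong (foldr ℕ._⊔_ 0)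
                    (map-cong {f = degree (K (suc n))} {g = λ _ → n} (degree-K (suc n)) (allFinL (suc n))))
              (⊔-const Fin.zero (tabulate {n = n} Fin.suc))
  where
  ⊔-const : ∀ {A : Set} (x : A) xs → foldr ℕ._⊔_ 0 (map (λ _ → n) (x ∷ xs)) ≡ n
  ⊔-const x []       = ℕ.⊔-identityʳ n
  ⊔-const x (y ∷ xs) = trans (cong (n ℕ.⊔_) (⊔-const y xs)) (ℕ.⊔-idem n)

f-K-≤ : ∀ n k → k ℕ.≤ n → f (K (suc n)) k ≡ suc n
f-K-≤ n k k≤n = trans (cong length (filter-all {P = λ x → k ℕ.≤ degree (K (suc n)) x} (λ x → k ℕ.≤? degree (K (suc n)) x)
                                     (tabulate⁺ {f = λ x → x} k≤degree)))
                      (length-tabulate (λ x → x))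
  where
  k≤degree : ∀ x → k ℕ.≤ degree (K (suc n)) x
  k≤degree x = subst (k ℕ.≤_) (sym (degree-K (suc n) x)) k≤n

f-K-> : ∀ n k → n ℕ.< k → f (K (suc n)) k ≡ 0
f-K-> n k n<k = cong length (filter-none {P = λ x → k ℕ.≤ degree (K (suc n)) x} (λ x → k ℕ.≤? degree (K (suc n)) x)
                                          (tabulate⁺ {f = λ x → x} k≰degree))
  where
  k≰degree : ∀ x → ¬ k ℕ.≤ degree (K (suc n)) x
  k≰degree x k≤d = ℕ.<⇒≱ n<k (subst (k ℕ.≤_) (degree-K (suc n) x) k≤d)

φ-K-plateau : ∀ n x → 0ℚ ≤ x → x ≤ ι n → φ (K (suc n)) x ≡ ι (suc n)
φ-K-plateau n x 0≤x x≤n =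
  trans (φ-at-floor (K (suc n)) x) (at-floor (floorℕ x) k₀≤x (ℕ.m≤n⇒m<n∨m≡n (ℕ→ℚ-cancel-≤ (ℚ.≤-trans k₀≤x x≤n))))
  where
  N : ℚ
  N = ι (suc n)
  k₀≤x : ι (floorℕ x) ≤ x
  k₀≤x = proj₁ (floor-bracket x 0≤x)
  at-floor : ∀ k₀ → ι k₀ ≤ x → k₀ ℕ.< n ⊎ k₀ ≡ n →
             interpolate (x - ι k₀) (ι (f (K (suc n)) k₀)) (ι (f (K (suc n)) (suc k₀))) ≡ N
  at-floor k₀ _ (inj₁ k₀<n) = begin
    interpolate (x - ι k₀) (ι (f (K (suc n)) k₀)) (ι (f (K (suc n)) (suc k₀)))
      ≡⟨ cong₂ (interpolate (x - ι k₀)) (cong ι (f-K-≤ n k₀ (ℕ.<⇒≤ k₀<n))) (cong ι (f-K-≤ n (suc k₀) k₀<n)) ⟩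
    interpolate (x - ι k₀) N N
      ≡⟨ interpolate-same (x - ι k₀) N ⟩
    N ∎
    where open ≡-Reasoning
  at-floor .n n≤x (inj₂ refl) = begin
    interpolate (x - ι n) (ι (f (K (suc n)) n)) v
      ≡⟨ cong₂ (λ t u → interpolate t u v) x-n≡0 (cong ι (f-K-≤ n n ℕ.≤-refl)) ⟩
    interpolate 0ℚ N v
      ≡⟨ interpolate-0 N v ⟩
    N ∎
    where
    open ≡-Reasoning
    v : ℚ
    v = ι (f (K (suc n)) (suc n))
    x-n≡0 : x - ι n ≡ 0ℚ
    x-n≡0 = trans (cong (_- ι n) (ℚ.≤-antisym x≤n n≤x)) (ℚ.+-inverseʳ (ι n))

φ-K-ramp : ∀ n x → ι n ≤ x → x ≤ ι (suc n) → φ (K (suc n)) x ≡ ι (suc n) * (ι (suc n) - x)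
φ-K-ramp n x n≤x x≤n+1 = begin
  φ (K (suc n)) x
    ≡⟨ φ-unit-interval (K (suc n)) n x n≤x x≤n+1 ⟩
  interpolate (x - ι n) (ι (f (K (suc n)) n)) (ι (f (K (suc n)) (suc n)))
    ≡⟨ cong₂ (interpolate (x - ι n)) (cong ι (f-K-≤ n n ℕ.≤-refl)) (cong ι (f-K-> n (suc n) ℕ.≤-refl)) ⟩
  interpolate (x - ι n) (ι (suc n)) 0ℚ
    ≡⟨ cong (λ N → interpolate (x - ι n) N 0ℚ) (ℕ→ℚ-suc n) ⟩
  interpolate (x - ι n) (1ℚ + ι n) 0ℚ
    ≡⟨ ramp x (ι n) ⟩
  (1ℚ + ι n) * ((1ℚ + ι n) - x)
    ≡⟨ cong (λ N → N * (N - x)) (ℕ→ℚ-suc n) ⟨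
  ι (suc n) * (ι (suc n) - x) ∎
  where
  open ≡-Reasoning
  ramp : ∀ x y → (1ℚ - (x - y)) * (1ℚ + y) + (x - y) * 0ℚ ≡ (1ℚ + y) * ((1ℚ + y) - x)
  ramp = solve 2 (λ x y → (con 1ℚ :- (x :- y)) :* (con 1ℚ :+ y) :+ (x :- y) :* con 0ℚ
                          := (con 1ℚ :+ y) :* ((con 1ℚ :+ y) :- x)) refl

φ-K-≤ : ∀ n x → 0ℚ ≤ x → x ≤ ι (suc n) → φ (K (suc n)) x ≤ ι (suc n) * (ι (suc n) - x)
φ-K-≤ n x 0≤x x≤n+1 = [ on-plateau , on-ramp ]′ (ℚ.≤-total x (ι n))
  where
  N : ℚ
  N = ι (suc n)
  on-ramp : ι n ≤ x → φ (K (suc n)) x ≤ N * (N - x)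
  on-ramp n≤x = ℚ.≤-reflexive (φ-K-ramp n x n≤x x≤n+1)
  excess : ∀ x y → (1ℚ + y) * ((1ℚ + y) - x) - (1ℚ + y) ≡ (1ℚ + y) * (y - x) - (1ℚ + y) * 0ℚ
  excess = solve 2 (λ x y → (con 1ℚ :+ y) :* ((con 1ℚ :+ y) :- x) :- (con 1ℚ :+ y)
                            := (con 1ℚ :+ y) :* (y :- x) :- (con 1ℚ :+ y) :* con 0ℚ) refl
  on-plateau : x ≤ ι n → φ (K (suc n)) x ≤ N * (N - x)
  on-plateau x≤n = subst (_≤ N * (N - x)) (sym (φ-K-plateau n x 0≤x x≤n))
    (≤-via-difference (ℚ.*-monoˡ-≤-nonNeg N {{ℕ→ℚ-nonNeg (suc n)}} (p≤q⇒0≤q-p x≤n))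
      (subst (λ N → N * (N - x) - N ≡ N * (ι n - x) - N * 0ℚ) (sym (ℕ→ℚ-suc n)) (excess x (ι n))))

MatchesWithin : ∀ {v w} → Graph v → Graph w → ℚ → ℕ → ℚ → Set
MatchesWithin F G ε d d' =
  1ℚ ≤ d' × d' ≤ ι (suc (Δ G)) × ∣ ι d - d' ∣ ≤ ε * ι d × ∣ φ F (ι d) - φ G d' ∣ ≤ ε * φ F (ι d)

matches-same-degree : ∀ {v w} (F : Graph v) (G : Graph w) {ε} d → 0ℚ ≤ ε → 1 ℕ.≤ d → d ℕ.≤ suc (Δ G) →
                      ∣ φ F (ι d) - φ G (ι d) ∣ ≤ ε * φ F (ι d) → MatchesWithin F G ε d (ι d)
matches-same-degree F G {ε} d 0≤ε 1≤d d≤Δ+1 φ-close =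
  ℕ→ℚ-mono-≤ 1≤d , ℕ→ℚ-mono-≤ d≤Δ+1 , subst (λ t → ∣ t ∣ ≤ ε * ι d) (sym (ℚ.+-inverseʳ (ι d))) 0≤εd , φ-close
  where
  0≤εd : 0ℚ ≤ ε * ι d
  0≤εd = ℚ.nonNegative⁻¹ _ {{ℚ.nonNeg*nonNeg⇒nonNeg ε {{ℚ.nonNegative 0≤ε}} (ι d) {{ℚ.nonNegative (0≤ℕ→ℚ d)}}}}

-- K_n and K_m for n = p + 2 and m = n + j

module _ (p j : ℕ) where

  private
    n' n m' m : ℕ
    n' = suc p
    n  = suc n'
    m' = n' ℕ.+ j
    m  = suc m'
    N M : ℚ
    N = ι n
    M = ι m
    N≤M : N ≤ M
    N≤M = ℕ→ℚ-mono-≤ (ℕ.m≤m+n n j)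

    φ-Kn-plateau : ∀ x → 0ℚ ≤ x → x ≤ ι n' → φ (K n) x ≡ N
    φ-Kn-plateau = φ-K-plateau n'

    φ-Km-plateau : ∀ x → 0ℚ ≤ x → x ≤ ι m' → φ (K m) x ≡ M
    φ-Km-plateau = φ-K-plateau m'

    a : ℚ
    a = + j / n

    0≤a : 0ℚ ≤ a
    0≤a = ℚ.nonNegative⁻¹ a {{ℚ.normalize-nonNeg j n}}

    ∣N-M∣≡aN : ∣ N - M ∣ ≡ a * N
    ∣N-M∣≡aN = trans (∣p-q∣≡q-p N≤M)
                     (trans (cong (_- N) (ℕ→ℚ-homo-+ n j)) (trans (difference N (ι j)) (sym (/-*-ℕ→ℚ j n))))
      where
      difference : ∀ x y → (x + y) - x ≡ y
      difference = solve 2 (λ x y → (x :+ y) :- x := y) refl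

    1+a≤m' : 1ℚ + a ≤ ι m'
    1+a≤m' = ℕ-scaled-≤⇒≤ n m≤m'n scaled-1+a (sym (ℕ→ℚ-homo-* m' n))
      where
      scaled-1+a : (1ℚ + a) * N ≡ M
      scaled-1+a = trans (ℚ.*-distribʳ-+ N 1ℚ a)
                         (trans (cong₂ _+_ (ℚ.*-identityˡ N) (/-*-ℕ→ℚ j n)) (sym (ℕ→ℚ-homo-+ n j)))
      identity : ∀ p j → (2 ℕ.+ p ℕ.+ j) ℕ.+ (p ℕ.* (2 ℕ.+ p ℕ.+ j) ℕ.+ j) ≡ (1 ℕ.+ p ℕ.+ j) ℕ.* (2 ℕ.+ p)
      identity = ℕ-solve-∀
      m≤m'n : m ℕ.≤ m' ℕ.* n
      m≤m'n = m+k≡n⇒m≤n (p ℕ.* m ℕ.+ j) (identity p j)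

  RHrOK-Kn-Km : RHrOK (K n) (K m) a
  RHrOK-Kn-Km d 1≤d d≤Δ = ι d , matches-same-degree (K n) (K m) d 0≤a 1≤d d≤m (ℚ.≤-reflexive φ-gap)
    where
    d≤n' : d ℕ.≤ n'
    d≤n' = subst (d ℕ.≤_) (Δ-K n') d≤Δ
    d≤m : d ℕ.≤ suc (Δ (K m))
    d≤m = subst (λ k → d ℕ.≤ suc k) (sym (Δ-K m')) (ℕ.m≤n⇒m≤1+n (ℕ.m≤n⇒m≤n+o j d≤n'))
    φ-gap : ∣ φ (K n) (ι d) - φ (K m) (ι d) ∣ ≡ a * φ (K n) (ι d)
    φ-gap = subst₂ (λ u v → ∣ u - v ∣ ≡ a * u)
              (sym (φ-Kn-plateau (ι d) (0≤ℕ→ℚ d) (ℕ→ℚ-mono-≤ d≤n')))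
              (sym (φ-Km-plateau (ι d) (0≤ℕ→ℚ d) (ℕ→ℚ-mono-≤ (ℕ.m≤n⇒m≤n+o j d≤n'))))
              ∣N-M∣≡aN

  RHrOK-Kn-Km-minimal : ∀ e → 0ℚ ≤ e → e < a → ¬ RHrOK (K n) (K m) e
  RHrOK-Kn-Km-minimal e _ e<a within-e = refute (within-e 1 ℕ.≤-refl (subst (1 ℕ.≤_) (sym (Δ-K n')) (s≤s z≤n)))
    where
    slack : ∀ d' e → (1ℚ + e) - d' ≡ e * 1ℚ - (d' - 1ℚ)
    slack = solve 2 (λ d' e → (con 1ℚ :+ e) :- d' := e :* con 1ℚ :- (d' :- con 1ℚ)) refl
    refute : ∃ (MatchesWithin (K n) (K m) e 1) → ⊥
    refute (d' , 1≤d' , _ , degree-close , φ-close) = ℚ.<-irrefl refl (ℚ.<-≤-trans e<a a≤e)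
      where
      d'≤m' : d' ≤ ι m'
      d'≤m' = ℚ.≤-trans (ℚ.<⇒≤ (ℚ.≤-<-trans (≤-via-difference (∣p-q∣≤r⇒q-p≤r {ι 1} {d'} degree-close) (slack d' e))
                                             (ℚ.+-monoʳ-< 1ℚ e<a)))
                        1+a≤m'
      φ-Kn-at-1 : φ (K n) (ι 1) ≡ N
      φ-Kn-at-1 = φ-Kn-plateau (ι 1) (0≤ℕ→ℚ 1) (ℕ→ℚ-mono-≤ {1} {n'} (s≤s z≤n))
      φ-Km-at-d' : φ (K m) d' ≡ M
      φ-Km-at-d' = φ-Km-plateau d' (ℚ.≤-trans (0≤ℕ→ℚ 1) 1≤d') d'≤m'
      a≤e : a ≤ e
      a≤e = *-cancelʳ-≤-ℕ→ℚ n (subst (_≤ e * N) ∣N-M∣≡aN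
                                 (subst₂ (λ u v → ∣ u - v ∣ ≤ e * u) φ-Kn-at-1 φ-Km-at-d' φ-close))

  IsRHr-Kn-Km : IsRHr (K n) (K m) a
  IsRHr-Kn-Km = 0≤a , RHrOK-Kn-Km , RHrOK-Kn-Km-minimal

  private
    -- D = nm + m − n, and 1 − β = (n + 1) j / D is RH_r(K_m, K_n).
    D : ℕ
    D = n ℕ.* m ℕ.+ j
    β c : ℚ
    β = + (n ℕ.* n) / D
    c = ι m' * β

    βD≡n² : β * ι D ≡ ι (n ℕ.* n)
    βD≡n² = /-*-ℕ→ℚ (n ℕ.* n) D

    D≡M+Nm' : ι D ≡ M + N * ι m'
    D≡M+Nm' = trans (cong ι (identity p j)) (trans (ℕ→ℚ-homo-+ m (n ℕ.* m')) (cong (_+_ M) (ℕ→ℚ-homo-* n m')))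
      where
      identity : ∀ p j → (2 ℕ.+ p) ℕ.* (2 ℕ.+ p ℕ.+ j) ℕ.+ j ≡ (2 ℕ.+ p ℕ.+ j) ℕ.+ (2 ℕ.+ p) ℕ.* (1 ℕ.+ p ℕ.+ j)
      identity = ℕ-solve-∀

    0≤β : 0ℚ ≤ β
    0≤β = ℚ.nonNegative⁻¹ β {{ℚ.normalize-nonNeg (n ℕ.* n) D}}

    β≤1 : β ≤ 1ℚ
    β≤1 = ℕ-scaled-≤⇒≤ D n²≤D βD≡n² (ℚ.*-identityˡ (ι D))
      where
      identity : ∀ p j → (2 ℕ.+ p) ℕ.* (2 ℕ.+ p) ℕ.+ (3 ℕ.+ p) ℕ.* j ≡ (2 ℕ.+ p) ℕ.* (2 ℕ.+ p ℕ.+ j) ℕ.+ j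
      identity = ℕ-solve-∀
      n²≤D : n ℕ.* n ℕ.≤ D
      n²≤D = m+k≡n⇒m≤n (suc n ℕ.* j) (identity p j)

    βM≤N : β * M ≤ N
    βM≤N = ℕ-scaled-≤⇒≤ D mn²≤nD βMD (sym (ℕ→ℚ-homo-* n D))
      where
      commute : ∀ β M D → β * M * D ≡ M * (β * D)
      commute = solve 3 (λ β M D → β :* M :* D := M :* (β :* D)) refl
      βMD : β * M * ι D ≡ ι (m ℕ.* (n ℕ.* n))
      βMD = trans (commute β M (ι D)) (trans (cong (M *_) βD≡n²) (sym (ℕ→ℚ-homo-* m (n ℕ.* n))))
      identity : ∀ p j → (2 ℕ.+ p ℕ.+ j) ℕ.* ((2 ℕ.+ p) ℕ.* (2 ℕ.+ p)) ℕ.+ (2 ℕ.+ p) ℕ.* j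
                         ≡ (2 ℕ.+ p) ℕ.* ((2 ℕ.+ p) ℕ.* (2 ℕ.+ p ℕ.+ j) ℕ.+ j)
      identity = ℕ-solve-∀
      mn²≤nD : m ℕ.* (n ℕ.* n) ℕ.≤ n ℕ.* D
      mn²≤nD = m+k≡n⇒m≤n (n ℕ.* j) (identity p j)

    cD≡m'n² : c * ι D ≡ ι (m' ℕ.* (n ℕ.* n))
    cD≡m'n² = trans (ℚ.*-assoc (ι m') β (ι D)) (trans (cong (ι m' *_) βD≡n²) (sym (ℕ→ℚ-homo-* m' (n ℕ.* n))))

    n'≤c : ι n' ≤ c
    n'≤c = ℕ-scaled-≤⇒≤ D n'D≤m'n² (sym (ℕ→ℚ-homo-* n' D)) cD≡m'n²
      where
      identity : ∀ p j → (1 ℕ.+ p) ℕ.* ((2 ℕ.+ p) ℕ.* (2 ℕ.+ p ℕ.+ j) ℕ.+ j) ℕ.+ j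
                         ≡ (1 ℕ.+ p ℕ.+ j) ℕ.* ((2 ℕ.+ p) ℕ.* (2 ℕ.+ p))
      identity = ℕ-solve-∀
      n'D≤m'n² : n' ℕ.* D ℕ.≤ m' ℕ.* (n ℕ.* n)
      n'D≤m'n² = m+k≡n⇒m≤n j (identity p j)

    c≤N : c ≤ N
    c≤N = ℕ-scaled-≤⇒≤ D m'n²≤nD cD≡m'n² (sym (ℕ→ℚ-homo-* n D))
      where
      identity : ∀ p j → (1 ℕ.+ p ℕ.+ j) ℕ.* ((2 ℕ.+ p) ℕ.* (2 ℕ.+ p)) ℕ.+ (2 ℕ.+ p) ℕ.* (2 ℕ.+ p ℕ.+ j)
                         ≡ (2 ℕ.+ p) ℕ.* ((2 ℕ.+ p) ℕ.* (2 ℕ.+ p ℕ.+ j) ℕ.+ j)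
      identity = ℕ-solve-∀
      m'n²≤nD : m' ℕ.* (n ℕ.* n) ℕ.≤ n ℕ.* D
      m'n²≤nD = m+k≡n⇒m≤n (n ℕ.* m) (identity p j)

    φ-Kn-at-c : φ (K n) c ≡ β * M
    φ-Kn-at-c = begin
      φ (K n) c                        ≡⟨ φ-K-ramp n' c n'≤c c≤N ⟩
      N * (N - ι m' * β)               ≡⟨ regroup N (ι m') β ⟩
      N * N - β * (N * ι m')           ≡⟨ cong (_- β * (N * ι m')) N²≡βD ⟩
      β * ι D - β * (N * ι m')         ≡⟨ cong (λ t → β * t - β * (N * ι m')) D≡M+Nm' ⟩
      β * (M + N * ι m') - β * (N * ι m') ≡⟨ cancel β M (N * ι m') ⟩
      β * M                            ∎
      where
      open ≡-Reasoning
      regroup : ∀ N k β → N * (N - k * β) ≡ N * N - β * (N * k)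
      regroup = solve 3 (λ N k β → N :* (N :- k :* β) := N :* N :- β :* (N :* k)) refl
      cancel : ∀ β M X → β * (M + X) - β * X ≡ β * M
      cancel = solve 3 (λ β M X → β :* (M :+ X) :- β :* X := β :* M) refl
      N²≡βD : N * N ≡ β * ι D
      N²≡βD = trans (sym (ℕ→ℚ-homo-* n n)) (sym βD≡n²)

    b : ℚ
    b = 1ℚ - β
    βM≤M : β * M ≤ M
    βM≤M = ℚ.≤-trans βM≤N N≤M

  RHrOK-Km-Kn : RHrOK (K m) (K n) b
  RHrOK-Km-Kn d 1≤d d≤Δ = [ low , high ]′ (ℕ.≤-<-connex d n')
    where
    d≤m' : d ℕ.≤ m'
    d≤m' = subst (d ℕ.≤_) (Δ-K m') d≤Δ
    φ-Km-at-d : φ (K m) (ι d) ≡ M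
    φ-Km-at-d = φ-Km-plateau (ι d) (0≤ℕ→ℚ d) (ℕ→ℚ-mono-≤ d≤m')
    low : d ℕ.≤ n' → ∃ (MatchesWithin (K m) (K n) b d)
    low d≤n' = ι d , matches-same-degree (K m) (K n) d (p≤q⇒0≤q-p β≤1) 1≤d d≤n+1 φ-gap
      where
      d≤n+1 : d ℕ.≤ suc (Δ (K n))
      d≤n+1 = subst (λ k → d ℕ.≤ suc k) (sym (Δ-K n')) (ℕ.m≤n⇒m≤1+n d≤n')
      slack : ∀ β M N → (1ℚ - β) * M - (M - N) ≡ N - β * M
      slack = solve 3 (λ β M N → (con 1ℚ :- β) :* M :- (M :- N) := N :- β :* M) refl
      φ-gap : ∣ φ (K m) (ι d) - φ (K n) (ι d) ∣ ≤ b * φ (K m) (ι d)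
      φ-gap = subst₂ (λ u v → ∣ u - v ∣ ≤ b * u)
                (sym φ-Km-at-d) (sym (φ-Kn-plateau (ι d) (0≤ℕ→ℚ d) (ℕ→ℚ-mono-≤ d≤n')))
                (subst (_≤ b * M) (sym (∣p-q∣≡p-q N≤M)) (≤-via-difference βM≤N (slack β M N)))
    high : n' ℕ.< d → ∃ (MatchesWithin (K m) (K n) b d)
    high n'<d = c , ℚ.≤-trans (ℕ→ℚ-mono-≤ {1} {n'} (s≤s z≤n)) n'≤c , subst (λ k → c ≤ ι (suc k)) (sym (Δ-K n')) c≤N
                  , degree-gap , φ-gap
      where
      c≤d : c ≤ ι d
      c≤d = ℚ.≤-trans c≤N (ℕ→ℚ-mono-≤ n'<d)
      slack : ∀ β d m' → (1ℚ - β) * d - (d - m' * β) ≡ β * m' - β * d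
      slack = solve 3 (λ β d m' → (con 1ℚ :- β) :* d :- (d :- m' :* β) := β :* m' :- β :* d) refl
      degree-gap : ∣ ι d - c ∣ ≤ b * ι d
      degree-gap = subst (_≤ b * ι d) (sym (∣p-q∣≡p-q c≤d))
                     (≤-via-difference (ℚ.*-monoˡ-≤-nonNeg β {{ℚ.nonNegative 0≤β}} (ℕ→ℚ-mono-≤ d≤m'))
                                       (slack β (ι d) (ι m')))
      factor : ∀ β M → M - β * M ≡ (1ℚ - β) * M
      factor = solve 2 (λ β M → M :- β :* M := (con 1ℚ :- β) :* M) refl
      φ-gap : ∣ φ (K m) (ι d) - φ (K n) c ∣ ≤ b * φ (K m) (ι d)
      φ-gap = subst₂ (λ u v → ∣ u - v ∣ ≤ b * u) (sym φ-Km-at-d) (sym φ-Kn-at-c)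
                (ℚ.≤-reflexive (trans (∣p-q∣≡p-q βM≤M) (factor β M)))

  RHrOK-Km-Kn-minimal : ∀ e → 0ℚ ≤ e → e < b → ¬ RHrOK (K m) (K n) e
  RHrOK-Km-Kn-minimal e _ e<b within-e = refute (within-e m' (s≤s z≤n) (subst (m' ℕ.≤_) (sym (Δ-K m')) ℕ.≤-refl))
    where
    refute : ∃ (MatchesWithin (K m) (K n) e m') → ⊥
    refute (d' , 1≤d' , d'≤Δ+1 , degree-close , φ-close) = ℚ.<-irrefl refl (ℚ.<-≤-trans e<b b≤e)
      where
      0≤d' : 0ℚ ≤ d'
      0≤d' = ℚ.≤-trans (0≤ℕ→ℚ 1) 1≤d'
      d'≤N : d' ≤ N
      d'≤N = subst (λ k → d' ≤ ι (suc k)) (Δ-K n') d'≤Δ+1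
      shrink : ∀ x y e → y - (1ℚ - e) * x ≡ e * x - (x - y)
      shrink = solve 3 (λ x y e → y :- (con 1ℚ :- e) :* x := e :* x :- (x :- y)) refl
      shrunk-degree : (1ℚ - e) * ι m' ≤ d'
      shrunk-degree = ≤-via-difference (∣p-q∣≤r⇒p-q≤r {ι m'} {d'} degree-close) (shrink (ι m') d' e)
      shrunk-φ : (1ℚ - e) * M ≤ N * (N - d')
      shrunk-φ = ℚ.≤-trans (≤-via-difference (∣p-q∣≤r⇒p-q≤r {M} {φ (K n) d'} φ-close′) (shrink M (φ (K n) d') e))
                           (φ-K-≤ n' d' 0≤d' d'≤N)
        where
        φ-close′ : ∣ M - φ (K n) d' ∣ ≤ e * M
        φ-close′ = subst (λ u → ∣ u - φ (K n) d' ∣ ≤ e * u) (φ-Km-plateau (ι m') (0≤ℕ→ℚ m') ℚ.≤-refl) φ-close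
      distribute : ∀ e M N k → (1ℚ - e) * (M + N * k) ≡ (1ℚ - e) * M + N * ((1ℚ - e) * k)
      distribute = solve 4 (λ e M N k → (con 1ℚ :- e) :* (M :+ N :* k)
                                        := (con 1ℚ :- e) :* M :+ N :* ((con 1ℚ :- e) :* k)) refl
      telescope : ∀ N x → N * (N - x) + N * x ≡ N * N
      telescope = solve 2 (λ N x → N :* (N :- x) :+ N :* x := N :* N) refl
      scaled : (1ℚ - e) * ι D ≤ β * ι D
      scaled = subst₂ _≤_ (sym (trans (cong ((1ℚ - e) *_) D≡M+Nm') (distribute e M N (ι m'))))
                           (trans (telescope N d') (trans (sym (ℕ→ℚ-homo-* n n)) (sym βD≡n²)))
                           (ℚ.+-mono-≤ shrunk-φ (ℚ.*-monoˡ-≤-nonNeg N {{ℕ→ℚ-nonNeg n}} shrunk-degree))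
      swap : ∀ e β → e - (1ℚ - β) ≡ β - (1ℚ - e)
      swap = solve 2 (λ e β → e :- (con 1ℚ :- β) := β :- (con 1ℚ :- e)) refl
      b≤e : b ≤ e
      b≤e = ≤-via-difference (*-cancelʳ-≤-ℕ→ℚ D {1ℚ - e} {β} scaled) (swap e β)

  IsRHr-Km-Kn : IsRHr (K m) (K n) b
  IsRHr-Km-Kn = p≤q⇒0≤q-p β≤1 , RHrOK-Km-Kn , RHrOK-Km-Kn-minimal

  RHr-Km-Kn≤RHr-Kn-Km : b ≤ a
  RHr-Km-Kn≤RHr-Kn-Km =
    *-cancelʳ-≤-ℕ→ℚ (n ℕ.* D) {b} {a} (≤-via-difference (ℕ→ℚ-mono-≤ (nD≤jD+n³ n j)) difference)
    where
    nD≤jD+n³ : ∀ n j → n ℕ.* (n ℕ.* (n ℕ.+ j) ℕ.+ j) ℕ.≤ j ℕ.* (n ℕ.* (n ℕ.+ j) ℕ.+ j) ℕ.+ n ℕ.* (n ℕ.* n)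
    nD≤jD+n³ n zero    = ℕ.≤-reflexive (identity n)
      where
      identity : ∀ n → n ℕ.* (n ℕ.* (n ℕ.+ 0) ℕ.+ 0) ≡ 0 ℕ.* (n ℕ.* (n ℕ.+ 0) ℕ.+ 0) ℕ.+ n ℕ.* (n ℕ.* n)
      identity = ℕ-solve-∀
    nD≤jD+n³ n (suc i) = m+k≡n⇒m≤n (suc i ℕ.* (i ℕ.* n ℕ.+ suc i)) (identity n i)
      where
      identity : ∀ n i → n ℕ.* (n ℕ.* (n ℕ.+ suc i) ℕ.+ suc i) ℕ.+ suc i ℕ.* (i ℕ.* n ℕ.+ suc i)
                         ≡ suc i ℕ.* (n ℕ.* (n ℕ.+ suc i) ℕ.+ suc i) ℕ.+ n ℕ.* (n ℕ.* n)
      identity = ℕ-solve-∀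
    regroup : ∀ a β N D → a * (N * D) - (1ℚ - β) * (N * D) ≡ (a * N) * D + N * (β * D) - N * D
    regroup = solve 4 (λ a β N D → a :* (N :* D) :- (con 1ℚ :- β) :* (N :* D)
                                   := (a :* N) :* D :+ N :* (β :* D) :- N :* D) refl
    difference : a * ι (n ℕ.* D) - (1ℚ - β) * ι (n ℕ.* D) ≡ ι (j ℕ.* D ℕ.+ n ℕ.* (n ℕ.* n)) - ι (n ℕ.* D)
    difference = begin
      a * ι (n ℕ.* D) - (1ℚ - β) * ι (n ℕ.* D)
        ≡⟨ cong (λ X → a * X - (1ℚ - β) * X) (ℕ→ℚ-homo-* n D) ⟩
      a * (N * ι D) - (1ℚ - β) * (N * ι D)
        ≡⟨ regroup a β N (ι D) ⟩
      (a * N) * ι D + N * (β * ι D) - N * ι D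
        ≡⟨ cong₂ (λ u v → u * ι D + N * v - N * ι D) (/-*-ℕ→ℚ j n) βD≡n² ⟩
      ι j * ι D + N * ι (n ℕ.* n) - N * ι D
        ≡⟨ cong₂ (λ u v → u + v - N * ι D) (ℕ→ℚ-homo-* j D) (ℕ→ℚ-homo-* n (n ℕ.* n)) ⟨
      ι (j ℕ.* D) + ι (n ℕ.* (n ℕ.* n)) - N * ι D
        ≡⟨ cong₂ _-_ (ℕ→ℚ-homo-+ (j ℕ.* D) (n ℕ.* (n ℕ.* n))) (ℕ→ℚ-homo-* n D) ⟨
      ι (j ℕ.* D ℕ.+ n ℕ.* (n ℕ.* n)) - ι (n ℕ.* D) ∎
      where open ≡-Reasoning

  IsRH-Kn-Km : IsRH (K n) (K m) (+ j / n)
  IsRH-Kn-Km = a , b , IsRHr-Kn-Km , IsRHr-Km-Kn , ℚ.p≥q⇒p⊔q≡p RHr-Km-Kn≤RHr-Kn-Km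

lemma4p2 : (n m : ℕ) → (h : 3 ℕ.≤ n) → n ℕ.≤ m →
    IsRH (K n) (K m) (_/_ (+ (m ℕ.∸ n)) n {{ℕ.>-nonZero (ℕ.≤-trans (s≤s z≤n) h)}})
lemma4p2 zero          _ ()       _
lemma4p2 (suc zero)    _ (s≤s ()) _
-- The argument only needs n ≥ 2.
lemma4p2 (suc (suc p)) m _ n≤m =
  subst (λ k → IsRH (K (suc (suc p))) (K k) (+ (m ∸ suc (suc p)) / suc (suc p)))
        (ℕ.m+[n∸m]≡n n≤m)
        (IsRH-Kn-Km p (m ∸ suc (suc p)))
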